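{- Let $\mathcal{K}$ be a category equipped with a proper factorisation system $(\mathcal{E},\mathcal{M})$, such that $\mathcal{K}$ is $\mathcal{M}$-wellpowered and has intersections of $\mathcal{M}$-subobjects (i.e. wide pullbacks of arbitrary families of $\mathcal{M}$-morphisms with common codomain). Let $T:\mathcal{K}\to\mathcal{K}$ be a functor that maps $\mathcal{M}$-morphisms to $\mathcal{M}$-morphisms. Then the following are equivalent: (1) for every object $X$ and every $\mathcal{M}$-subobject $\alpha: Z\rightarrowtail TX$, a base $\mathrm{base}_X(\alpha)$ of $\alpha$ exists; (2) $T$ preserves intersections of $\mathcal{M}$-subobjects. Moreover, under either condition, $\mathrm{base}_X(\alpha)$ is the intersection $\bigcap\{m \mid m\in \mathrm{Sub}_{\mathcal{M}}(X),\ \alpha\subseteq Tm\}$ of all $\mathcal{M}$-subobjects $m$ of $X$ with $\alpha\subseteq Tm$ in $\mathrm{Sub}_{\mathcal{M}}(TX)$.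
   Context: A factorisation system $(\mathcal{E},\mathcal{M})$ on $\mathcal{K}$ consists of classes $\mathcal{E},\mathcal{M}$ of morphisms closed under composition with isomorphisms, such that every morphism factors as a member of $\mathcal{E}$ followed by a member of $\mathcal{M}$, and every commutative square $v e = m u$ with $e\in\mathcal{E}$, $m\in\mathcal{M}$ has a unique diagonal $d$ with $de=u$, $md=v$. It is proper if every member of $\mathcal{E}$ is an epimorphism and every member of $\mathcal{M}$ a monomorphism. For $\mathcal{M}$-morphisms $m:Z\rightarrowtail X$, $m':Z'\rightarrowtail X$ write $m\subseteq m'$ if $m$ factors through $m'$; an $\mathcal{M}$-subobject of $X$ is an equivalence class of $\mathcal{M}$-morphisms into $X$ under the equivalence generated by $\subseteq$, and $\mathrm{Sub}_{\mathcal{M}}(X)$ is the poset of these ordered by $\subseteq$. $\mathcal{K}$ is $\mathcal{M}$-wellpowered if each $\mathrm{Sub}_{\mathcal{M}}(X)$ is a set. $T$ preserves intersections of $\mathcal{M}$-subobjects if it maps each such wide pullback to a wide pullback. An $\mathcal{M}$-subobject $b$ of $X$ is a base of an $\mathcal{M}$-subobject $\alpha$ of $TX$ if for every $\mathcal{M}$-subobject $m$ of $X$: $b\subseteq m$ in $\mathrm{Sub}_{\mathcal{M}}(X)$ iff $\alpha\subseteq Tm$ in $\mathrm{Sub}_{\mathcal{M}}(TX)$. -}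

module Defs where

open import Level using (Level; _⊔_; suc)
open import Data.Product using (Σ; _×_; _,_)
open import Function using (_∘′_)
open import Function.Bundles using (_⇔_)
open import Relation.Binary.Structures using (IsEquivalence)

-- Categories (hom-setoids; Hom and its equality live in Set ℓ,
-- so "small" means "indexed by a type in Set ℓ")

record Category (o ℓ : Level) : Set (suc (o ⊔ ℓ)) where
  infixr 9 _∘_
  infix  4 _≈_
  field
    Obj      : Set o
    Hom      : Obj → Obj → Set ℓ
    _≈_      : ∀ {A B} → Hom A B → Hom A B → Set ℓ
    id       : ∀ {A} → Hom A A
    _∘_      : ∀ {A B C} → Hom B C → Hom A B → Hom A C
    equiv    : ∀ {A B} → IsEquivalence (_≈_ {A} {B})
    ∘-resp-≈ : ∀ {A B C} {f h : Hom B C} {g i : Hom A B} →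
               f ≈ h → g ≈ i → f ∘ g ≈ h ∘ i
    assoc     : ∀ {A B C D} {f : Hom A B} {g : Hom B C} {h : Hom C D} →
                (h ∘ g) ∘ f ≈ h ∘ (g ∘ f)
    identityˡ : ∀ {A B} {f : Hom A B} → id ∘ f ≈ f
    identityʳ : ∀ {A B} {f : Hom A B} → f ∘ id ≈ f

record Functor {o ℓ : Level} (C D : Category o ℓ) : Set (o ⊔ ℓ) where
  private
    module C = Category C
    module D = Category D
  field
    F₀           : C.Obj → D.Obj
    F₁           : ∀ {A B} → C.Hom A B → D.Hom (F₀ A) (F₀ B)
    identity     : ∀ {A} → F₁ (C.id {A}) D.≈ D.id
    homomorphism : ∀ {A B E} {f : C.Hom A B} {g : C.Hom B E} →
                   F₁ (g C.∘ f) D.≈ F₁ g D.∘ F₁ f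
    F-resp-≈     : ∀ {A B} {f g : C.Hom A B} → f C.≈ g → F₁ f D.≈ F₁ g

module _ {o ℓ : Level} (C : Category o ℓ) where
  open Category C

  MorClass : (p : Level) → Set (o ⊔ ℓ ⊔ suc p)
  MorClass p = ∀ {A B} → Hom A B → Set p

  record IsIso {A B : Obj} (f : Hom A B) : Set ℓ where
    field
      inv  : Hom B A
      isoˡ : inv ∘ f ≈ id
      isoʳ : f ∘ inv ≈ id

  Mono : ∀ {A B} → Hom A B → Set (o ⊔ ℓ)
  Mono {A} f = ∀ {Z} (g h : Hom Z A) → f ∘ g ≈ f ∘ h → g ≈ h

  Epi : ∀ {A B} → Hom A B → Set (o ⊔ ℓ)
  Epi {B = B} f = ∀ {Z} (g h : Hom B Z) → g ∘ f ≈ h ∘ f → g ≈ h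

  record ClosedUnderIsos {p : Level} (K : MorClass p) : Set (o ⊔ ℓ ⊔ p) where
    field
      resp-≈  : ∀ {A B} {f g : Hom A B} → f ≈ g → K f → K g
      iso-∘ˡ  : ∀ {A B B'} {f : Hom A B} {i : Hom B B'} → IsIso i → K f → K (i ∘ f)
      iso-∘ʳ  : ∀ {A' A B} {f : Hom A B} {i : Hom A' A} → IsIso i → K f → K (f ∘ i)

  record FactorisationSystem {p : Level} (E M : MorClass p) : Set (o ⊔ ℓ ⊔ p) where
    field
      E-closed  : ClosedUnderIsos E
      M-closed  : ClosedUnderIsos M
      factorise : ∀ {A B} (f : Hom A B) →
                  Σ Obj λ Z → Σ (Hom A Z) λ e → Σ (Hom Z B) λ m →
                    E e × M m × (m ∘ e ≈ f)
      diagonal  : ∀ {A B C' D} {e : Hom A B} {m : Hom C' D}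
                    {u : Hom A C'} {v : Hom B D} →
                  E e → M m → v ∘ e ≈ m ∘ u →
                  Σ (Hom B C') λ d → (d ∘ e ≈ u) × (m ∘ d ≈ v)
      diagonal-unique : ∀ {A B C' D} {e : Hom A B} {m : Hom C' D}
                    {u : Hom A C'} {v : Hom B D} →
                  E e → M m → v ∘ e ≈ m ∘ u →
                  (d d' : Hom B C') →
                  (d ∘ e ≈ u) → (m ∘ d ≈ v) →
                  (d' ∘ e ≈ u) → (m ∘ d' ≈ v) → d ≈ d'

  Proper : {p : Level} (E M : MorClass p) → Set (o ⊔ ℓ ⊔ p)
  Proper E M = (∀ {A B} {f : Hom A B} → E f → Epi f)
             × (∀ {A B} {f : Hom A B} → M f → Mono f)

  -- M-morphisms with codomain X (representatives of M-subobjects)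
  record SubM {p : Level} (M : MorClass p) (X : Obj) : Set (o ⊔ ℓ ⊔ p) where
    constructor sub
    field
      dom : Obj
      arr : Hom dom X
      inM : M arr
  open SubM public

  _⊆_ : {p : Level} {M : MorClass p} {X : Obj} → SubM M X → SubM M X → Set ℓ
  m ⊆ m' = Σ (Hom (dom m) (dom m')) λ h → arr m' ∘ h ≈ arr m

  record IsWidePullback {I : Set ℓ} {X : Obj} (D : I → Obj)
         (g : (i : I) → Hom (D i) X)
         (P : Obj) (p : Hom P X) (π : (i : I) → Hom P (D i)) : Set (o ⊔ ℓ) where
    field
      commute   : ∀ i → g i ∘ π i ≈ p
      universal : ∀ {Q} (q : Hom Q X) (qs : (i : I) → Hom Q (D i)) →
                  (∀ i → g i ∘ qs i ≈ q) →
                  Σ (Hom Q P) λ u → (p ∘ u ≈ q) × (∀ i → π i ∘ u ≈ qs i)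
      unique    : ∀ {Q} (u u' : Hom Q P) →
                  p ∘ u ≈ p ∘ u' → (∀ i → π i ∘ u ≈ π i ∘ u') → u ≈ u'

  HasIntersections : {p : Level} (M : MorClass p) → Set (o ⊔ suc ℓ ⊔ p)
  HasIntersections M = ∀ (X : Obj) (I : Set ℓ) (f : I → SubM M X) →
    Σ Obj λ P → Σ (Hom P X) λ q → Σ ((i : I) → Hom P (dom (f i))) λ π →
      IsWidePullback (λ i → dom (f i)) (λ i → arr (f i)) P q π

  -- M-wellpowered: Sub_M(X) is small, i.e. there is a small set of
  -- representatives of all M-subobjects of X
  WellPowered : {p : Level} (M : MorClass p) → Set (o ⊔ suc ℓ ⊔ p)
  WellPowered M = ∀ (X : Obj) →
    Σ (Set ℓ) λ I → Σ (I → SubM M X) λ s →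
      ∀ (m : SubM M X) → Σ I λ i → (m ⊆ s i) × (s i ⊆ m)

module _ {o ℓ : Level} (C : Category o ℓ) {p : Level} (M : MorClass C p)
         (T : Functor C C) where
  open Category C
  open Functor T

  PreservesM : Set (o ⊔ ℓ ⊔ p)
  PreservesM = ∀ {A B} {f : Hom A B} → M f → M (F₁ f)

  PreservesIntersections : Set (o ⊔ suc ℓ ⊔ p)
  PreservesIntersections = ∀ (X : Obj) (I : Set ℓ) (f : I → SubM C M X)
    (P : Obj) (q : Hom P X) (π : (i : I) → Hom P (dom (f i))) →
    IsWidePullback C (λ i → dom (f i)) (λ i → arr (f i)) P q π →
    IsWidePullback C (λ i → F₀ (dom (f i))) (λ i → F₁ (arr (f i)))
                   (F₀ P) (F₁ q) (λ i → F₁ (π i))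

  module _ (presM : PreservesM) where
    TSub : ∀ {X} → SubM C M X → SubM C M (F₀ X)
    TSub m = sub (F₀ (dom m)) (F₁ (arr m)) (presM (inM m))

    IsBase : ∀ {X} → SubM C M X → SubM C M (F₀ X) → Set (o ⊔ ℓ ⊔ p)
    IsBase {X} b α = ∀ (m : SubM C M X) →
      (_⊆_ C b m) ⇔ (_⊆_ C α (TSub m))

    AllBasesExist : Set (o ⊔ ℓ ⊔ p)
    AllBasesExist = ∀ (X : Obj) (α : SubM C M (F₀ X)) →
      Σ (SubM C M X) λ b → IsBase b α

-- (1) ⇒ (2): given a cone over the T (f i), the image α of its apex leg lies
-- below every T (f i); so the base of α lies below every f i, hence below their
-- intersection P, hence α lies below T P, which gives the mediating map
-- (unique because T P ↣ T X is monic).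
-- (2) ⇒ (1): by wellpoweredness the m with α ⊆ T m form a small family; T preserves
-- their intersection, so α lies below T of it, while the intersection lies below
-- every such m: it is a base of α.
module Submission where

open import Defs
open import Level using (Level)
open import Data.Product using (Σ; _×_; _,_; proj₁; proj₂)
open import Data.Sum using (_⊎_; [_,_]′)
open import Function.Bundles using (_⇔_; mk⇔; Equivalence)
open import Relation.Binary.Bundles using (Setoid)
open import Relation.Binary.Structures using (IsEquivalence)
import Relation.Binary.Reasoning.Setoid as SetoidReasoning

module CategoryReasoning {o ℓ : Level} (C : Category o ℓ) where
  open Category C

  hom-setoid : Obj → Obj → Setoid ℓ ℓ
  hom-setoid A B = record { isEquivalence = equiv {A} {B} }

  module HomEquiv {A B : Obj} = IsEquivalence (equiv {A} {B})
  module HomReasoning {A B : Obj} = SetoidReasoning (hom-setoid A B)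

  pullˡ : ∀ {A B D E} {f : Hom A B} {g : Hom B D} {h : Hom D E} {k : Hom B E} →
          h ∘ g ≈ k → h ∘ (g ∘ f) ≈ k ∘ f
  pullˡ hg≈k = HomEquiv.trans (HomEquiv.sym assoc) (∘-resp-≈ hg≈k HomEquiv.refl)

module Subobjects {o ℓ p : Level} (C : Category o ℓ) (M : MorClass C p) where
  open Category C
  open CategoryReasoning C

  ⊆-trans : ∀ {X} {a b c : SubM C M X} → _⊆_ C a b → _⊆_ C b c → _⊆_ C a c
  ⊆-trans (h , bh≈a) (k , ck≈b) = k ∘ h , HomEquiv.trans (pullˡ ck≈b) bh≈a

  module Intersection {X : Obj} {I : Set ℓ} (f : I → SubM C M X)
         {P : Obj} {q : Hom P X} {π : (i : I) → Hom P (dom (f i))}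
         (wp : IsWidePullback C (λ i → dom (f i)) (λ i → arr (f i)) P q π)
         (qM : M q) where
    open IsWidePullback wp

    intersection-⊆ : ∀ i → _⊆_ C (sub P q qM) (f i)
    intersection-⊆ i = π i , commute i

    ⊆-intersection : ∀ {a : SubM C M X} → (∀ i → _⊆_ C a (f i)) → _⊆_ C a (sub P q qM)
    ⊆-intersection {a} a⊆f =
      let u , qu≈a , _ = universal (arr a) (λ i → proj₁ (a⊆f i)) (λ i → proj₂ (a⊆f i))
      in u , qu≈a

module Factorisation {o ℓ p : Level} (C : Category o ℓ) (E M : MorClass C p)
       (FS : FactorisationSystem C E M) where
  open Category C
  open CategoryReasoning C
  open FactorisationSystem FS

  image-⊆ : ∀ {A X Z} {h : Hom A X} {e : Hom A Z} {m : Hom Z X} (mM : M m) →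
            E e → m ∘ e ≈ h →
            ∀ (g : SubM C M X) {k : Hom A (dom g)} → arr g ∘ k ≈ h →
            _⊆_ C (sub Z m mM) g
  image-⊆ _ eE me≈h g gk≈h =
    let d , _ , gd≈m = diagonal eE (inM g) (HomEquiv.trans me≈h (HomEquiv.sym gk≈h))
    in d , gd≈m

  -- Factor q = m ∘ e; the diagonals into the f i assemble to a retraction r of e,
  -- and uniqueness of diagonals for the square m ∘ e = m ∘ e forces e ∘ r ≈ id.
  M-closed-under-wide-pullbacks :
    ∀ {X} {I : Set ℓ} (f : I → SubM C M X) {P} {q : Hom P X}
      {π : (i : I) → Hom P (dom (f i))} →
    IsWidePullback C (λ i → dom (f i)) (λ i → arr (f i)) P q π → M q
  M-closed-under-wide-pullbacks f {P} {q} {π} wp with factorise q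
  ... | Z , e , m , eE , mM , me≈q =
    ClosedUnderIsos.resp-≈ M-closed me≈q (ClosedUnderIsos.iso-∘ʳ M-closed e-iso mM)
    where
      open IsWidePullback wp
      open HomReasoning

      lift : ∀ i → Σ (Hom Z (dom (f i))) λ d → (d ∘ e ≈ π i) × (arr (f i) ∘ d ≈ m)
      lift i = diagonal eE (inM (f i)) (HomEquiv.trans me≈q (HomEquiv.sym (commute i)))

      retraction = universal m (λ i → proj₁ (lift i)) (λ i → proj₂ (proj₂ (lift i)))
      r = proj₁ retraction

      r∘e≈id : r ∘ e ≈ id
      r∘e≈id = unique (r ∘ e) id
        (begin q ∘ (r ∘ e) ≈⟨ pullˡ (proj₁ (proj₂ retraction)) ⟩
               m ∘ e       ≈⟨ me≈q ⟩
               q           ≈⟨ identityʳ ⟨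
               q ∘ id      ∎)
        (λ i → begin π i ∘ (r ∘ e)         ≈⟨ pullˡ (proj₂ (proj₂ retraction) i) ⟩
                     proj₁ (lift i) ∘ e    ≈⟨ proj₁ (proj₂ (lift i)) ⟩
                     π i                   ≈⟨ identityʳ ⟨
                     π i ∘ id              ∎)

      e∘r≈id : e ∘ r ≈ id
      e∘r≈id = diagonal-unique eE mM HomEquiv.refl (e ∘ r) id
        (begin (e ∘ r) ∘ e ≈⟨ assoc ⟩
               e ∘ (r ∘ e) ≈⟨ ∘-resp-≈ HomEquiv.refl r∘e≈id ⟩
               e ∘ id      ≈⟨ identityʳ ⟩
               e           ∎)
        (begin m ∘ (e ∘ r) ≈⟨ pullˡ me≈q ⟩
               q ∘ r       ≈⟨ proj₁ (proj₂ retraction) ⟩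
               m           ∎)
        identityˡ identityʳ

      e-iso : IsIso C e
      e-iso = record { inv = r ; isoˡ = r∘e≈id ; isoʳ = e∘r≈id }

module Bases {o ℓ p : Level} (C : Category o ℓ) (E M : MorClass C p)
       (FS : FactorisationSystem C E M) (T : Functor C C) (presM : PreservesM C M T) where
  open Category C
  open Functor T
  open CategoryReasoning C
  open Subobjects C M
  open Factorisation C E M FS

  T-monotone : ∀ {X} {a b : SubM C M X} → _⊆_ C a b →
           _⊆_ C (TSub C M T presM a) (TSub C M T presM b)
  T-monotone (h , bh≈a) = F₁ h , HomEquiv.trans (HomEquiv.sym homomorphism) (F-resp-≈ bh≈a)

  intersection-is-base :
    ∀ {X} (α : SubM C M (F₀ X)) {J : Set ℓ} (f : J → SubM C M X) →
    (∀ j → _⊆_ C α (TSub C M T presM (f j))) →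
    (∀ (m : SubM C M X) → _⊆_ C α (TSub C M T presM m) →
       Σ J λ j → (_⊆_ C m (f j)) × (_⊆_ C (f j) m)) →
    ∀ {P} {q : Hom P X} {π : (j : J) → Hom P (dom (f j))} →
    IsWidePullback C (λ j → dom (f j)) (λ j → arr (f j)) P q π →
    IsWidePullback C (λ j → F₀ (dom (f j))) (λ j → F₁ (arr (f j))) (F₀ P) (F₁ q) (λ j → F₁ (π j)) →
    (qM : M q) → IsBase C M T presM (sub P q qM) α
  intersection-is-base {X} α f α⊆Tf f-exhausts {P} {q} wp Twp qM m = mk⇔
    (λ P⊆m → ⊆-trans {a = α} {b = TP} {c = TSub C M T presM m} α⊆TP
                       (T-monotone {a = intersection} {b = m} P⊆m))
    (λ α⊆Tm → let j , _ , fj⊆m = f-exhausts m α⊆Tm in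
              ⊆-trans {a = intersection} {b = f j} {c = m} (intersection-⊆ j) fj⊆m)
    where
      open Intersection f wp qM
      intersection : SubM C M X
      intersection = sub P q qM
      TP : SubM C M (F₀ X)
      TP = TSub C M T presM intersection
      α⊆TP : _⊆_ C α TP
      α⊆TP = Intersection.⊆-intersection (λ j → TSub C M T presM (f j)) Twp (presM qM) {a = α} α⊆Tf

  bases⇒preservesIntersections :
    Proper C E M → AllBasesExist C M T presM → PreservesIntersections C M T
  bases⇒preservesIntersections (_ , M-mono) bases X I f P q π wp = record
    { commute   = Tf∘Tπ≈Tq
    ; universal = universal-T
    ; unique    = λ u u' Tq∘u≈Tq∘u' _ → M-mono (presM qM) u u' Tq∘u≈Tq∘u'
    }
    where
      open IsWidePullback wp
      qM = M-closed-under-wide-pullbacks f wp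
      open Intersection f wp qM

      Tf∘Tπ≈Tq : ∀ i → F₁ (arr (f i)) ∘ F₁ (π i) ≈ F₁ q
      Tf∘Tπ≈Tq i = HomEquiv.trans (HomEquiv.sym homomorphism) (F-resp-≈ (commute i))

      universal-T : ∀ {Q} (q' : Hom Q (F₀ X)) (qs : (i : I) → Hom Q (F₀ (dom (f i)))) →
                    (∀ i → F₁ (arr (f i)) ∘ qs i ≈ q') →
                    Σ (Hom Q (F₀ P)) λ u → (F₁ q ∘ u ≈ q') × (∀ i → F₁ (π i) ∘ u ≈ qs i)
      universal-T q' qs cone with FactorisationSystem.factorise FS q'
      ... | Z , e , m , eE , mM , m∘e≈q' = h ∘ e , Tq∘h∘e≈q' , Tπ∘h∘e≈qs
        where
          α : SubM C M (F₀ X)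
          α = sub Z m mM
          open Equivalence
          b = proj₁ (bases X α)
          b-base = proj₂ (bases X α)
          α⊆Tf : ∀ i → _⊆_ C α (TSub C M T presM (f i))
          α⊆Tf i = image-⊆ mM eE m∘e≈q' (TSub C M T presM (f i)) (cone i)
          b⊆P : _⊆_ C b (sub P q qM)
          b⊆P = ⊆-intersection {a = b} (λ i → from (b-base (f i)) (α⊆Tf i))
          α⊆TP : _⊆_ C α (TSub C M T presM (sub P q qM))
          α⊆TP = to (b-base (sub P q qM)) b⊆P
          h = proj₁ α⊆TP

          Tq∘h∘e≈q' : F₁ q ∘ (h ∘ e) ≈ q'
          Tq∘h∘e≈q' = HomEquiv.trans (pullˡ (proj₂ α⊆TP)) m∘e≈q'

          Tπ∘h∘e≈qs : ∀ i → F₁ (π i) ∘ (h ∘ e) ≈ qs i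
          Tπ∘h∘e≈qs i = M-mono (presM (inM (f i))) _ _ (begin
            F₁ (arr (f i)) ∘ (F₁ (π i) ∘ (h ∘ e)) ≈⟨ pullˡ (Tf∘Tπ≈Tq i) ⟩
            F₁ q ∘ (h ∘ e)                        ≈⟨ Tq∘h∘e≈q' ⟩
            q'                                    ≈⟨ cone i ⟨
            F₁ (arr (f i)) ∘ qs i                 ∎)
            where open HomReasoning

  preservesIntersections⇒bases :
    WellPowered C M → HasIntersections C M →
    PreservesIntersections C M T → AllBasesExist C M T presM
  preservesIntersections⇒bases wellPowered intersections preserves X α =
    sub P q qM , intersection-is-base α f proj₂ f-exhausts wp (preserves X J f P q π wp) qM
    where
      open Σ (wellPowered X) renaming (proj₁ to I; proj₂ to representatives)
      s = proj₁ representatives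

      J : Set ℓ
      J = Σ I λ i → _⊆_ C α (TSub C M T presM (s i))

      f : J → SubM C M X
      f j = s (proj₁ j)

      f-exhausts : ∀ (m : SubM C M X) → _⊆_ C α (TSub C M T presM m) →
                   Σ J λ j → (_⊆_ C m (f j)) × (_⊆_ C (f j) m)
      f-exhausts m α⊆Tm =
        let i , m⊆si , si⊆m = proj₂ representatives m
            α⊆Tsi = ⊆-trans {a = α} {b = TSub C M T presM m} {c = TSub C M T presM (s i)}
                      α⊆Tm (T-monotone {a = m} {b = s i} m⊆si)
        in (i , α⊆Tsi) , m⊆si , si⊆m

      P = proj₁ (intersections X J f)
      q = proj₁ (proj₂ (intersections X J f))
      π = proj₁ (proj₂ (proj₂ (intersections X J f)))
      wp = proj₂ (proj₂ (proj₂ (intersections X J f)))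
      qM = M-closed-under-wide-pullbacks f wp

proposition3p11 : ∀ {o ℓ p : Level} (C : Category o ℓ)
    (E M : MorClass C p) →
    FactorisationSystem C E M →
    Proper C E M →
    WellPowered C M →
    HasIntersections C M →
    (T : Functor C C) →
    (presM : PreservesM C M T) →
    (AllBasesExist C M T presM ⇔ PreservesIntersections C M T)
    × ((AllBasesExist C M T presM ⊎ PreservesIntersections C M T) →
       ∀ (X : Category.Obj C)
         (α : SubM C M (Functor.F₀ T X))
         (J : Set ℓ) (f : J → SubM C M X) →
         (∀ j → _⊆_ C α (TSub C M T presM (f j))) →
         (∀ (m : SubM C M X) → _⊆_ C α (TSub C M T presM m) →
            Σ J λ j → (_⊆_ C m (f j)) × (_⊆_ C (f j) m)) →
         ∀ (P : Category.Obj C) (q : Category.Hom C P X)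
           (π : (j : J) → Category.Hom C P (SubM.dom (f j))) →
         IsWidePullback C (λ j → SubM.dom (f j)) (λ j → SubM.arr (f j)) P q π →
         Σ (M q) λ qM → IsBase C M T presM (sub P q qM) α)
proposition3p11 C E M FS proper wellPowered intersections T presM =
  mk⇔ (bases⇒preservesIntersections proper) (preservesIntersections⇒bases wellPowered intersections)
  , λ condition X α J f α⊆Tf f-exhausts P q π wp →
      let preserves = [ bases⇒preservesIntersections proper , (λ preserves → preserves) ]′ condition
          qM = M-closed-under-wide-pullbacks f wp
      in qM , intersection-is-base α f α⊆Tf f-exhausts wp (preserves X J f P q π wp) qM
  where
    open Factorisation C E M FS
    open Bases C E M FS T presM
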